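{- (a) $\mathbf{F}_{p,\exists}=\mathbf{P}_{p,\exists}=\mathrm{Th}_\exists(\mathbb{F}_p)$ for all $p\in\mathbb{P}\cup\{0\}$; (b) $\mathbf{F}_\exists=\mathbf{P}_\exists$; (c) $\mathbf{F}_{>0,\exists}=\mathbf{P}_{>0,\exists}$; (d) $\mathbf{F}_{\gg0,\exists}=\mathbf{P}_{\gg0,\exists}$.
   Context: $\mathbb{P}$ is the set of primes, $\mathbb{F}_0:=\mathbb{Q}$. In the language of rings $\{+,\cdot,-,0,1\}$, $\mathbf{F}$ is the theory of fields and $\mathbf{P}=\bigcap_{p\in\mathbb{P}\cup\{0\}}\mathrm{Th}(\mathbb{F}_p)$ the theory of prime fields. $\mathrm{Sent}_\exists$ is the smallest set of ring sentences containing $\top,\perp$ and all $\exists y_1\dots\exists y_n\psi$ with $\psi$ quantifier-free, closed under $\wedge,\vee$; $S_\exists:=S^{\vdash}\cap\mathrm{Sent}_\exists$ for any theory $S$ (with $\vdash$ deductive closure), and $\mathrm{Th}_\exists(K)=\mathrm{Th}(K)\cap\mathrm{Sent}_\exists$. With $\rho_n$ the sentence $\neg(1+\dots+1=0)$ ($n$ ones), for a theory $T$: $T_0:=(T\cup\{\rho_n:n\ge1\})^{\vdash}$, $T_n:=(T\cup\{\rho_1,\dots,\rho_{n-1},\neg\rho_n\})^{\vdash}$, $T_{>0}:=\bigcap_{n\ge1}T_n$, $T_{\gg0}:=\bigcup_m\bigcap_{n\ge m}T_n$, and $T_{X,\exists}:=T_X\cap\mathrm{Sent}_\exists$. -}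

module Defs where

open import Level using (Level; _⊔_) renaming (suc to lsuc; zero to 0ℓ)
open import Data.Nat using (ℕ; zero; suc; _+_; _∸_; _≤_; _<_)
open import Data.Nat.DivMod using (_mod_)
open import Data.Nat.Primality using (Prime)
open import Data.Fin using (Fin; toℕ)
import Data.Fin as Fin
open import Data.Vec.Functional using (_∷_)
open import Data.Product using (Σ; _×_)
open import Data.Sum using (_⊎_)
open import Data.Unit using (⊤)
open import Data.Empty using (⊥)
open import Relation.Nullary using (¬_)
open import Relation.Binary.PropositionalEquality using (_≡_)
import Data.Rational as ℚ

data Term (n : ℕ) : Set where
  var     : Fin n → Term n
  _⊕_ _⊗_ : Term n → Term n → Term n
  ⊖_      : Term n → Term n
  𝟘 𝟙     : Term n

infixl 6 _⊕_
infixl 7 _⊗_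
infix  4 _≐_
infixr 3 _∧ᶠ_
infixr 2 _∨ᶠ_
infixr 1 _⇒ᶠ_

data Formula (n : ℕ) : Set where
  ⊤ᶠ ⊥ᶠ            : Formula n
  _≐_              : Term n → Term n → Formula n
  ¬ᶠ_              : Formula n → Formula n
  _∧ᶠ_ _∨ᶠ_ _⇒ᶠ_   : Formula n → Formula n → Formula n
  ∀ᶠ ∃ᶠ            : Formula (suc n) → Formula n   -- binds var zero

Sentence : Set
Sentence = Formula 0

-- Structures and (classical, Gödel–Gentzen / double-negation) satisfaction

record Structure : Set₁ where
  field
    Carrier : Set
    add mul : Carrier → Carrier → Carrier
    neg     : Carrier → Carrier
    zer one : Carrier

module _ (M : Structure) where
  open Structure M

  eval : ∀ {n} → (Fin n → Carrier) → Term n → Carrier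
  eval ρ (var i) = ρ i
  eval ρ (s ⊕ t) = add (eval ρ s) (eval ρ t)
  eval ρ (s ⊗ t) = mul (eval ρ s) (eval ρ t)
  eval ρ (⊖ t)   = neg (eval ρ t)
  eval ρ 𝟘       = zer
  eval ρ 𝟙       = one

  Sat : ∀ {n} → (Fin n → Carrier) → Formula n → Set
  Sat ρ ⊤ᶠ       = ⊤
  Sat ρ ⊥ᶠ       = ⊥
  Sat ρ (s ≐ t)  = ¬ ¬ (eval ρ s ≡ eval ρ t)
  Sat ρ (¬ᶠ φ)   = ¬ Sat ρ φ
  Sat ρ (φ ∧ᶠ ψ) = Sat ρ φ × Sat ρ ψ
  Sat ρ (φ ∨ᶠ ψ) = ¬ ¬ (Sat ρ φ ⊎ Sat ρ ψ)
  Sat ρ (φ ⇒ᶠ ψ) = Sat ρ φ → Sat ρ ψ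
  Sat ρ (∀ᶠ φ)   = (a : Carrier) → Sat (a ∷ ρ) φ
  Sat ρ (∃ᶠ φ)   = ¬ ¬ (Σ Carrier λ a → Sat (a ∷ ρ) φ)

infix 4 _⊨_
_⊨_ : Structure → Sentence → Set
M ⊨ φ = Sat M (λ ()) φ

Theory : (ℓ : Level) → Set (lsuc ℓ)
Theory ℓ = Sentence → Set ℓ

Th : Structure → Theory 0ℓ
Th K φ = K ⊨ φ

-- deductive closure S^⊢ (via the completeness theorem: semantic consequence)
Cl : ∀ {ℓ} → Theory ℓ → Theory (lsuc 0ℓ ⊔ ℓ)
Cl S φ = (M : Structure) → ((ψ : Sentence) → S ψ → M ⊨ ψ) → M ⊨ φ

_∪_ : ∀ {a b} → Theory a → Theory b → Theory (a ⊔ b)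
(A ∪ B) φ = A φ ⊎ B φ

_∩_ : ∀ {a b} → Theory a → Theory b → Theory (a ⊔ b)
(A ∩ B) φ = A φ × B φ

infix 4 _≗ₜ_
_≗ₜ_ : ∀ {a b} → Theory a → Theory b → Set (a ⊔ b)
A ≗ₜ B = (φ : Sentence) → (A φ → B φ) × (B φ → A φ)

data QF {n : ℕ} : Formula n → Set where
  qf-⊤ : QF ⊤ᶠ
  qf-⊥ : QF ⊥ᶠ
  qf-≐ : ∀ {s t} → QF (s ≐ t)
  qf-¬ : ∀ {φ} → QF φ → QF (¬ᶠ φ)
  qf-∧ : ∀ {φ ψ} → QF φ → QF ψ → QF (φ ∧ᶠ ψ)
  qf-∨ : ∀ {φ ψ} → QF φ → QF ψ → QF (φ ∨ᶠ ψ)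
  qf-⇒ : ∀ {φ ψ} → QF φ → QF ψ → QF (φ ⇒ᶠ ψ)

data ExPrefix : {n : ℕ} → Formula n → Set where
  base : ∀ {n} {ψ : Formula n} → QF ψ → ExPrefix ψ
  ex   : ∀ {n} {ψ : Formula (suc n)} → ExPrefix ψ → ExPrefix (∃ᶠ ψ)

data SentEx : Sentence → Set where
  top : SentEx ⊤ᶠ
  bot : SentEx ⊥ᶠ
  pre : ∀ {φ} → ExPrefix φ → SentEx φ
  and : ∀ {φ ψ} → SentEx φ → SentEx ψ → SentEx (φ ∧ᶠ ψ)
  or  : ∀ {φ ψ} → SentEx φ → SentEx ψ → SentEx (φ ∨ᶠ ψ)

_∃ₜ : ∀ {ℓ} → Theory ℓ → Theory (lsuc 0ℓ ⊔ ℓ)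
(S ∃ₜ) = Cl S ∩ SentEx

Th∃ : Structure → Theory 0ℓ
Th∃ K = Th K ∩ SentEx

-- 1 + ⋯ + 1  (n ones; n ≥ 1 is the intended range)
ones : ℕ → Term 0
ones zero          = 𝟘
ones (suc zero)    = 𝟙
ones (suc (suc k)) = ones (suc k) ⊕ 𝟙

ρ : ℕ → Sentence
ρ n = ¬ᶠ (ones n ≐ 𝟘)

CharAx : ℕ → Theory 0ℓ
CharAx zero    ψ = Σ ℕ λ n → 1 ≤ n × ψ ≡ ρ n
CharAx (suc m) ψ = (Σ ℕ λ k → 1 ≤ k × k < suc m × ψ ≡ ρ k) ⊎ ψ ≡ ¬ᶠ ρ (suc m)

_at_ : ∀ {ℓ} → Theory ℓ → ℕ → Theory (lsuc 0ℓ ⊔ ℓ)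
(T at n) = Cl (T ∪ CharAx n)

_at_∃ : ∀ {ℓ} → Theory ℓ → ℕ → Theory (lsuc 0ℓ ⊔ ℓ)
(T at n ∃) = (T at n) ∩ SentEx

_>0 : ∀ {ℓ} → Theory ℓ → Theory (lsuc 0ℓ ⊔ ℓ)
(T >0) φ = (n : ℕ) → 1 ≤ n → (T at n) φ

_≫0 : ∀ {ℓ} → Theory ℓ → Theory (lsuc 0ℓ ⊔ ℓ)
(T ≫0) φ = Σ ℕ λ m → (n : ℕ) → m ≤ n → 1 ≤ n → (T at n) φ

_>0∃ : ∀ {ℓ} → Theory ℓ → Theory (lsuc 0ℓ ⊔ ℓ)
(T >0∃) = (T >0) ∩ SentEx

_≫0∃ : ∀ {ℓ} → Theory ℓ → Theory (lsuc 0ℓ ⊔ ℓ)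
(T ≫0∃) = (T ≫0) ∩ SentEx

private
  x₀ : Term 1
  x₀ = var Fin.zero
  v : ∀ {n} → Fin n → Term n
  v = var

data FieldAx : Theory 0ℓ where
  add-assoc : FieldAx (∀ᶠ (∀ᶠ (∀ᶠ ((v (Fin.suc (Fin.suc Fin.zero)) ⊕ v (Fin.suc Fin.zero)) ⊕ v Fin.zero
                                 ≐ v (Fin.suc (Fin.suc Fin.zero)) ⊕ (v (Fin.suc Fin.zero) ⊕ v Fin.zero)))))
  add-zero  : FieldAx (∀ᶠ (x₀ ⊕ 𝟘 ≐ x₀))
  add-neg   : FieldAx (∀ᶠ (x₀ ⊕ (⊖ x₀) ≐ 𝟘))
  add-comm  : FieldAx (∀ᶠ (∀ᶠ (v (Fin.suc Fin.zero) ⊕ v Fin.zero ≐ v Fin.zero ⊕ v (Fin.suc Fin.zero))))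
  mul-assoc : FieldAx (∀ᶠ (∀ᶠ (∀ᶠ ((v (Fin.suc (Fin.suc Fin.zero)) ⊗ v (Fin.suc Fin.zero)) ⊗ v Fin.zero
                                 ≐ v (Fin.suc (Fin.suc Fin.zero)) ⊗ (v (Fin.suc Fin.zero) ⊗ v Fin.zero)))))
  mul-one   : FieldAx (∀ᶠ (x₀ ⊗ 𝟙 ≐ x₀))
  mul-comm  : FieldAx (∀ᶠ (∀ᶠ (v (Fin.suc Fin.zero) ⊗ v Fin.zero ≐ v Fin.zero ⊗ v (Fin.suc Fin.zero))))
  distrib   : FieldAx (∀ᶠ (∀ᶠ (∀ᶠ (v (Fin.suc (Fin.suc Fin.zero)) ⊗ (v (Fin.suc Fin.zero) ⊕ v Fin.zero)
                                 ≐ v (Fin.suc (Fin.suc Fin.zero)) ⊗ v (Fin.suc Fin.zero)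
                                   ⊕ v (Fin.suc (Fin.suc Fin.zero)) ⊗ v Fin.zero))))
  zero≠one  : FieldAx (¬ᶠ (𝟘 ≐ 𝟙))
  inverse   : FieldAx (∀ᶠ (¬ᶠ (x₀ ≐ 𝟘) ⇒ᶠ ∃ᶠ (v (Fin.suc Fin.zero) ⊗ v Fin.zero ≐ 𝟙)))

𝐅 : Theory 0ℓ
𝐅 = FieldAx

-- Prime fields: 𝔽 0 = ℚ, 𝔽 p = ℤ/pℤ for p ≥ 1 (a field when p is prime)

ℚ-str : Structure
ℚ-str = record { Carrier = ℚ.ℚ ; add = ℚ._+_ ; mul = ℚ._*_ ; neg = ℚ.-_ ; zer = ℚ.0ℚ ; one = ℚ.1ℚ }

ℤmod : (k : ℕ) → Structure
ℤmod k = record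
  { Carrier = Fin (suc k)
  ; add = λ a b → (toℕ a + toℕ b) mod (suc k)
  ; mul = λ a b → (toℕ a Data.Nat.* toℕ b) mod (suc k)
  ; neg = λ a → (suc k ∸ toℕ a) mod (suc k)
  ; zer = 0 mod (suc k)
  ; one = 1 mod (suc k)
  }

𝔽 : ℕ → Structure
𝔽 zero    = ℚ-str
𝔽 (suc k) = ℤmod k

PrimeOr0 : ℕ → Set
PrimeOr0 p = Prime p ⊎ p ≡ 0

𝐏 : Theory 0ℓ
𝐏 φ = (p : ℕ) → PrimeOr0 p → 𝔽 p ⊨ φ

-- A field K of characteristic p (0 or a prime) contains a copy of the prime field 𝔽 p:
-- n / m ↦ n·1 / m·1 when p = 0, and a ↦ a·1 when p > 0.  Existential sentences go up along
-- such embeddings, so an existential sentence true in 𝔽 p holds in every field of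
-- characteristic p, while 𝔽 p is itself a model of 𝐏 and of the characteristic-p axioms:
-- Th∃(𝔽 p) ⊆ 𝐅_{p,∃} ⊆ 𝐏_{p,∃} ⊆ Th∃(𝔽 p).  The same argument applies to a field of
-- characteristic n ≥ 1 (then n is prime) and, after splitting on the characteristic,
-- to an arbitrary field, which gives (b)-(d).
-- Satisfaction is classical (¬¬-translated), so the embedding, the inverses in K and the
-- characteristic itself are only available under ¬¬; this is harmless because satisfaction
-- is ¬¬-stable.

module Submission where

open import Defs
open import Level using (0ℓ)
open import Function using (id; _∘_; _$_; _⇔_; mk⇔; Equivalence)
open import Function.Construct.Identity using (⇔-id)
open import Function.Related.TypeIsomorphisms using (¬-cong-⇔; →-cong-⇔)
open import Data.Empty using (⊥-elim)
open import Data.Unit using (tt)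
open import Data.Product as Product using (∃-syntax; _×_; _,_; proj₁; proj₂)
open import Data.Product.Function.NonDependent.Propositional using (_×-⇔_)
open import Data.Sum as Sum using (_⊎_; inj₁; inj₂)
open import Data.Sum.Function.Propositional using (_⊎-⇔_)
open import Data.Nat as ℕ using (ℕ; zero; suc; _∸_; _≤_; _<_; NonZero)
import Data.Nat.Properties as ℕ
open import Data.Nat.Induction using (<-rec)
open import Data.Nat.DivMod
  using (_%_; _/_; _mod_; m≡m%n+[m/n]*n; %-distribˡ-+; %-distribˡ-*; m<n⇒m%n≡m; n%n≡0; [m+kn]%n≡m%n)
open import Data.Nat.Divisibility using (quotient; quotient>1; quotient-<; m∣n⇒n≡quotient*m)
open import Data.Nat.GCD using (module Bézout)
open import Data.Nat.Coprimality using (Coprime; coprime-Bézout; prime⇒coprime)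
open import Data.Nat.Primality using (Prime; prime; composite; prime⇒nonTrivial)
open import Data.Nat.Tactic.RingSolver using (solve-∀)
open import Data.Fin using (Fin; toℕ)
import Data.Fin as Fin
open import Data.Fin.Properties using (toℕ-fromℕ<; toℕ-injective; toℕ<n)
open import Data.Vec.Functional using (_∷_)
open import Data.Integer as ℤ using (ℤ; +_; -[1+_]; _⊖_)
import Data.Integer.Properties as ℤ
open import Data.Integer.Properties using ([+m]-[+n]≡m⊖n; [1+m]⊖[1+n]≡m⊖n)
import Data.Integer.Tactic.RingSolver as ℤ-Solver
open import Data.Rational using (0ℚ; 1ℚ; toℚᵘ)
import Data.Rational as ℚ
import Data.Rational.Properties as ℚ
open import Data.Rational.Unnormalised as ℚᵘ using (ℚᵘ; mkℚᵘ; _≃_; *≡*)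
import Data.Rational.Unnormalised.Properties as ℚᵘ
open import Relation.Nullary using (¬_; Stable; yes; no)
open import Relation.Nullary.Negation using (¬¬-Monad; ¬¬-map; negated-stable; contradiction)
open import Relation.Nullary.Decidable using (¬¬-excluded-middle)
open import Relation.Unary using (_⊆_)
open import Relation.Binary using (Rel; IsEquivalence; Setoid; tri<; tri≈; tri>)
open import Relation.Binary.PropositionalEquality as ≡ using (_≡_; _≢_; module ≡-Reasoning)
open import Effect.Monad using (RawMonad)
open import Algebra.Bundles using (Ring; CommutativeRing)
open import Algebra.Structures using (IsCommutativeRing)
import Algebra.Consequences.Setoid as Consequences

open RawMonad (¬¬-Monad {0ℓ}) using (pure; _>>=_)

Sat-stable : ∀ M {n} (ρ : Fin n → Structure.Carrier M) φ → Stable (Sat M ρ φ)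
Sat-stable M ρ ⊤ᶠ       _    = tt
Sat-stable M ρ ⊥ᶠ       ¬¬⊥  = ¬¬⊥ id
Sat-stable M ρ (s ≐ t)  = negated-stable
Sat-stable M ρ (¬ᶠ φ)   = negated-stable
Sat-stable M ρ (φ ∧ᶠ ψ) ¬¬s  = Sat-stable M ρ φ (¬¬-map proj₁ ¬¬s) , Sat-stable M ρ ψ (¬¬-map proj₂ ¬¬s)
Sat-stable M ρ (φ ∨ᶠ ψ) = negated-stable
Sat-stable M ρ (φ ⇒ᶠ ψ) ¬¬f a = Sat-stable M ρ ψ (¬¬-map (_$ a) ¬¬f)
Sat-stable M ρ (∀ᶠ φ)   ¬¬f a = Sat-stable M (a ∷ ρ) φ (¬¬-map (_$ a) ¬¬f)
Sat-stable M ρ (∃ᶠ φ)   = negated-stable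

infix 4 _⊨ₜ_
_⊨ₜ_ : ∀ {ℓ} → Structure → Theory ℓ → Set ℓ
M ⊨ₜ T = ∀ ψ → T ψ → M ⊨ ψ

-- A homomorphism A → M up to ¬¬, presented as a relation because its values (for A = ℚ:
-- quotients in M) exist only under ¬¬.
record Embedding (A M : Structure) : Set₁ where
  private
    module A = Structure A
    module M = Structure M
  infix 4 _∼_
  field
    _∼_          : A.Carrier → M.Carrier → Set
    ∼-total      : ∀ a → ¬ ¬ (∃[ b ] a ∼ b)
    ∼-zer        : A.zer ∼ M.zer
    ∼-one        : A.one ∼ M.one
    ∼-add        : ∀ {a b c d} → a ∼ b → c ∼ d → A.add a c ∼ M.add b d
    ∼-mul        : ∀ {a b c d} → a ∼ b → c ∼ d → A.mul a c ∼ M.mul b d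
    ∼-neg        : ∀ {a b} → a ∼ b → A.neg a ∼ M.neg b
    ∼-functional : ∀ {a b c} → a ∼ b → a ∼ c → ¬ ¬ (b ≡ c)
    ∼-injective  : ∀ {a b c} → a ∼ c → b ∼ c → ¬ ¬ (a ≡ b)

module _ {A M : Structure} (f : Embedding A M) where
  open Embedding f
  private
    module A = Structure A
    module M = Structure M

  eval-∼ : ∀ {n} {ρA : Fin n → A.Carrier} {ρM} → (∀ i → ρA i ∼ ρM i) →
           ∀ t → eval A ρA t ∼ eval M ρM t
  eval-∼ ρ∼ (var i) = ρ∼ i
  eval-∼ ρ∼ (s ⊕ t) = ∼-add (eval-∼ ρ∼ s) (eval-∼ ρ∼ t)
  eval-∼ ρ∼ (s ⊗ t) = ∼-mul (eval-∼ ρ∼ s) (eval-∼ ρ∼ t)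
  eval-∼ ρ∼ (⊖ t)   = ∼-neg (eval-∼ ρ∼ t)
  eval-∼ ρ∼ 𝟘       = ∼-zer
  eval-∼ ρ∼ 𝟙       = ∼-one

  ∼-≡ : ∀ {a b c d} → a ∼ b → c ∼ d → (¬ ¬ a ≡ c) ⇔ (¬ ¬ b ≡ d)
  ∼-≡ a∼b c∼d = mk⇔
    (λ a≡c → a≡c >>= λ { ≡.refl → ∼-functional a∼b c∼d })
    (λ b≡d → b≡d >>= λ { ≡.refl → ∼-injective a∼b c∼d })

  QF-⇔ : ∀ {n} {ρA : Fin n → A.Carrier} {ρM} → (∀ i → ρA i ∼ ρM i) →
         ∀ {ψ} → QF ψ → Sat A ρA ψ ⇔ Sat M ρM ψ
  QF-⇔ ρ∼ qf-⊤           = ⇔-id _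
  QF-⇔ ρ∼ qf-⊥           = ⇔-id _
  QF-⇔ ρ∼ (qf-≐ {s} {t}) = ∼-≡ (eval-∼ ρ∼ s) (eval-∼ ρ∼ t)
  QF-⇔ ρ∼ (qf-¬ φ)       = ¬-cong-⇔ (QF-⇔ ρ∼ φ)
  QF-⇔ ρ∼ (qf-∧ φ ψ)     = QF-⇔ ρ∼ φ ×-⇔ QF-⇔ ρ∼ ψ
  QF-⇔ ρ∼ (qf-∨ φ ψ)     = ¬-cong-⇔ (¬-cong-⇔ (QF-⇔ ρ∼ φ ⊎-⇔ QF-⇔ ρ∼ ψ))
  QF-⇔ ρ∼ (qf-⇒ φ ψ)     = →-cong-⇔ (QF-⇔ ρ∼ φ) (QF-⇔ ρ∼ ψ)

  ExPrefix-preserved : ∀ {n} {ρA : Fin n → A.Carrier} {ρM} → (∀ i → ρA i ∼ ρM i) →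
                       ∀ {ψ} → ExPrefix ψ → Sat A ρA ψ → Sat M ρM ψ
  ExPrefix-preserved ρ∼ (base φ) = Equivalence.to (QF-⇔ ρ∼ φ)
  ExPrefix-preserved ρ∼ (ex φ) ∃a = ∃a >>= λ (a , sat) → ∼-total a >>= λ (b , a∼b) →
    pure (b , ExPrefix-preserved (λ { Fin.zero → a∼b ; (Fin.suc i) → ρ∼ i }) φ sat)

  SentEx-preserved : ∀ {φ} → SentEx φ → A ⊨ φ → M ⊨ φ
  SentEx-preserved top       = id
  SentEx-preserved bot       = id
  SentEx-preserved (pre φ)   = ExPrefix-preserved (λ ()) φ
  SentEx-preserved (and φ ψ) = Product.map (SentEx-preserved φ) (SentEx-preserved ψ)
  SentEx-preserved (or φ ψ)  = ¬¬-map (Sum.map (SentEx-preserved φ) (SentEx-preserved ψ))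

⊖-+-⊖ : ∀ a b c d → (a ⊖ b) ℤ.+ (c ⊖ d) ≡ (a ℕ.+ c) ⊖ (b ℕ.+ d)
⊖-+-⊖ a b c d = begin
  (a ⊖ b) ℤ.+ (c ⊖ d)                  ≡⟨ ≡.cong₂ ℤ._+_ ([+m]-[+n]≡m⊖n a b) ([+m]-[+n]≡m⊖n c d) ⟨
  (+ a ℤ.- + b) ℤ.+ (+ c ℤ.- + d)      ≡⟨ regroup (+ a) (+ b) (+ c) (+ d) ⟩
  (+ a ℤ.+ + c) ℤ.- (+ b ℤ.+ + d)      ≡⟨ ≡.cong₂ ℤ._-_ (ℤ.pos-+ a c) (ℤ.pos-+ b d) ⟨
  + (a ℕ.+ c) ℤ.- + (b ℕ.+ d)          ≡⟨ [+m]-[+n]≡m⊖n (a ℕ.+ c) (b ℕ.+ d) ⟩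
  (a ℕ.+ c) ⊖ (b ℕ.+ d)                ∎
  where
  open ≡-Reasoning
  regroup : ∀ x y z w → (x ℤ.- y) ℤ.+ (z ℤ.- w) ≡ (x ℤ.+ z) ℤ.- (y ℤ.+ w)
  regroup = ℤ-Solver.solve-∀

⊖-*-⊖ : ∀ a b c d → (a ⊖ b) ℤ.* (c ⊖ d) ≡ (a ℕ.* c ℕ.+ b ℕ.* d) ⊖ (a ℕ.* d ℕ.+ b ℕ.* c)
⊖-*-⊖ a b c d = begin
  (a ⊖ b) ℤ.* (c ⊖ d)                  ≡⟨ ≡.cong₂ ℤ._*_ ([+m]-[+n]≡m⊖n a b) ([+m]-[+n]≡m⊖n c d) ⟨
  (+ a ℤ.- + b) ℤ.* (+ c ℤ.- + d)      ≡⟨ expand (+ a) (+ b) (+ c) (+ d) ⟩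
  (+ a ℤ.* + c ℤ.+ + b ℤ.* + d) ℤ.- (+ a ℤ.* + d ℤ.+ + b ℤ.* + c)
    ≡⟨ ≡.cong₂ ℤ._-_ (pos-+-* a c b d) (pos-+-* a d b c) ⟨
  + (a ℕ.* c ℕ.+ b ℕ.* d) ℤ.- + (a ℕ.* d ℕ.+ b ℕ.* c)
    ≡⟨ [+m]-[+n]≡m⊖n (a ℕ.* c ℕ.+ b ℕ.* d) (a ℕ.* d ℕ.+ b ℕ.* c) ⟩
  (a ℕ.* c ℕ.+ b ℕ.* d) ⊖ (a ℕ.* d ℕ.+ b ℕ.* c) ∎
  where
  open ≡-Reasoning
  expand : ∀ x y z w → (x ℤ.- y) ℤ.* (z ℤ.- w) ≡ (x ℤ.* z ℤ.+ y ℤ.* w) ℤ.- (x ℤ.* w ℤ.+ y ℤ.* z)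
  expand = ℤ-Solver.solve-∀
  pos-+-* : ∀ m n o r → + (m ℕ.* n ℕ.+ o ℕ.* r) ≡ + m ℤ.* + n ℤ.+ + o ℤ.* + r
  pos-+-* m n o r = ≡.trans (ℤ.pos-+ (m ℕ.* n) (o ℕ.* r)) (≡.cong₂ ℤ._+_ (ℤ.pos-* m n) (ℤ.pos-* o r))

ℤ-as-⊖ : ∀ i → ∃[ m ] ∃[ n ] i ≡ m ⊖ n
ℤ-as-⊖ (+ m)    = m , 0 , ≡.refl
ℤ-as-⊖ -[1+ n ] = 0 , suc n , ≡.refl

module CanonicalMap {c ℓ} (R : Ring c ℓ) where
  open Ring R
  open import Algebra.Properties.Ring R
    using (-0#≈0#; -‿+-comm; x[y-z]≈xy-xz; [y-z]x≈yx-zx; ⁻¹-anti-homo‿-)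
  open import Algebra.Properties.Semiring.Mult.TCOptimised semiring
    using (1+×; ×-homo-+; ×1-homo-*) renaming (_×_ to _·_)
  open import Algebra.Properties.CommutativeSemigroup +-commutativeSemigroup
    using () renaming (interchange to +-interchange)
  open import Relation.Binary.Reasoning.Setoid setoid

  ι : ℕ → Carrier
  ι n = n · 1#

  ι-+ : ∀ m n → ι (m ℕ.+ n) ≈ ι m + ι n
  ι-+ = ×-homo-+ 1#

  ι-* : ∀ m n → ι (m ℕ.* n) ≈ ι m * ι n
  ι-* = ×1-homo-*

  [x+z]-[y+w]≈[x-y]+[z-w] : ∀ x y z w → (x + z) - (y + w) ≈ (x - y) + (z - w)
  [x+z]-[y+w]≈[x-y]+[z-w] x y z w = begin
    (x + z) - (y + w)     ≈⟨ +-congˡ (-‿+-comm y w) ⟨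
    (x + z) + (- y + - w) ≈⟨ +-interchange x z (- y) (- w) ⟩
    (x - y) + (z - w)     ∎

  [x-y][z-w]≈[xz+yw]-[xw+yz] : ∀ x y z w → (x - y) * (z - w) ≈ (x * z + y * w) - (x * w + y * z)
  [x-y][z-w]≈[xz+yw]-[xw+yz] x y z w = begin
    (x - y) * (z - w)                   ≈⟨ [y-z]x≈yx-zx (z - w) x y ⟩
    x * (z - w) - y * (z - w)           ≈⟨ +-cong (x[y-z]≈xy-xz x z w) (-‿cong (x[y-z]≈xy-xz y z w)) ⟩
    (x * z - x * w) - (y * z - y * w)   ≈⟨ +-congˡ (⁻¹-anti-homo‿- (y * z) (y * w)) ⟩
    (x * z - x * w) + (y * w - y * z)   ≈⟨ [x+z]-[y+w]≈[x-y]+[z-w] (x * z) (x * w) (y * w) (y * z) ⟨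
    (x * z + y * w) - (x * w + y * z)   ∎

  ιℤ : ℤ → Carrier
  ιℤ (+ n)    = ι n
  ιℤ -[1+ n ] = - ι (suc n)

  ιℤ-⊖ : ∀ m n → ιℤ (m ⊖ n) ≈ ι m - ι n
  ιℤ-⊖ zero    zero    = sym (-‿inverseʳ 0#)
  ιℤ-⊖ zero    (suc n) = sym (+-identityˡ _)
  ιℤ-⊖ (suc m) zero    = sym (trans (+-congˡ -0#≈0#) (+-identityʳ _))
  ιℤ-⊖ (suc m) (suc n) = begin
    ιℤ (suc m ⊖ suc n)          ≡⟨ ≡.cong ιℤ ([1+m]⊖[1+n]≡m⊖n m n) ⟩
    ιℤ (m ⊖ n)                  ≈⟨ ιℤ-⊖ m n ⟩
    ι m - ι n                   ≈⟨ +-identityˡ (ι m - ι n) ⟨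
    0# + (ι m - ι n)            ≈⟨ +-congʳ (-‿inverseʳ 1#) ⟨
    (1# - 1#) + (ι m - ι n)     ≈⟨ [x+z]-[y+w]≈[x-y]+[z-w] 1# 1# (ι m) (ι n) ⟨
    (1# + ι m) - (1# + ι n)     ≈⟨ +-cong (1+× m 1#) (-‿cong (1+× n 1#)) ⟨
    ι (suc m) - ι (suc n)       ∎

  ιℤ-+ : ∀ i j → ιℤ (i ℤ.+ j) ≈ ιℤ i + ιℤ j
  ιℤ-+ i j with ℤ-as-⊖ i | ℤ-as-⊖ j
  ... | a , b , ≡.refl | c , d , ≡.refl = begin
    ιℤ ((a ⊖ b) ℤ.+ (c ⊖ d))        ≡⟨ ≡.cong ιℤ (⊖-+-⊖ a b c d) ⟩
    ιℤ ((a ℕ.+ c) ⊖ (b ℕ.+ d))      ≈⟨ ιℤ-⊖ (a ℕ.+ c) (b ℕ.+ d) ⟩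
    ι (a ℕ.+ c) - ι (b ℕ.+ d)       ≈⟨ +-cong (ι-+ a c) (-‿cong (ι-+ b d)) ⟩
    (ι a + ι c) - (ι b + ι d)       ≈⟨ [x+z]-[y+w]≈[x-y]+[z-w] (ι a) (ι b) (ι c) (ι d) ⟩
    (ι a - ι b) + (ι c - ι d)       ≈⟨ +-cong (ιℤ-⊖ a b) (ιℤ-⊖ c d) ⟨
    ιℤ (a ⊖ b) + ιℤ (c ⊖ d)         ∎

  ιℤ-* : ∀ i j → ιℤ (i ℤ.* j) ≈ ιℤ i * ιℤ j
  ιℤ-* i j with ℤ-as-⊖ i | ℤ-as-⊖ j
  ... | a , b , ≡.refl | c , d , ≡.refl = begin
    ιℤ ((a ⊖ b) ℤ.* (c ⊖ d))                            ≡⟨ ≡.cong ιℤ (⊖-*-⊖ a b c d) ⟩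
    ιℤ ((a ℕ.* c ℕ.+ b ℕ.* d) ⊖ (a ℕ.* d ℕ.+ b ℕ.* c))  ≈⟨ ιℤ-⊖ (a ℕ.* c ℕ.+ b ℕ.* d) (a ℕ.* d ℕ.+ b ℕ.* c) ⟩
    ι (a ℕ.* c ℕ.+ b ℕ.* d) - ι (a ℕ.* d ℕ.+ b ℕ.* c)   ≈⟨ +-cong (ι-+-* a c b d) (-‿cong (ι-+-* a d b c)) ⟩
    (ι a * ι c + ι b * ι d) - (ι a * ι d + ι b * ι c)   ≈⟨ [x-y][z-w]≈[xz+yw]-[xw+yz] (ι a) (ι b) (ι c) (ι d) ⟨
    (ι a - ι b) * (ι c - ι d)                           ≈⟨ *-cong (ιℤ-⊖ a b) (ιℤ-⊖ c d) ⟨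
    ιℤ (a ⊖ b) * ιℤ (c ⊖ d)                             ∎
    where
    ι-+-* : ∀ m n o r → ι (m ℕ.* n ℕ.+ o ℕ.* r) ≈ ι m * ι n + ι o * ι r
    ι-+-* m n o r = trans (ι-+ (m ℕ.* n) (o ℕ.* r)) (+-cong (ι-* m n) (ι-* o r))

  ιℤ-neg : ∀ i → ιℤ (ℤ.- i) ≈ - ιℤ i
  ιℤ-neg i with ℤ-as-⊖ i
  ... | a , b , ≡.refl = begin
    ιℤ (ℤ.- (a ⊖ b))  ≡⟨ ≡.cong ιℤ (ℤ.⊖-swap b a) ⟨
    ιℤ (b ⊖ a)        ≈⟨ ιℤ-⊖ b a ⟩
    ι b - ι a         ≈⟨ ⁻¹-anti-homo‿- (ι a) (ι b) ⟨
    - (ι a - ι b)     ≈⟨ -‿cong (ιℤ-⊖ a b) ⟨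
    - ιℤ (a ⊖ b)      ∎

module FieldModel (M : Structure) (M⊨𝐅 : M ⊨ₜ 𝐅) where
  open Structure M

  -- Satisfaction of s ≐ t is ¬¬-equality, so M is a commutative ring for this equivalence.
  infix 4 _≈_
  _≈_ : Rel Carrier 0ℓ
  x ≈ y = ¬ ¬ (x ≡ y)

  ≈-isEquivalence : IsEquivalence _≈_
  ≈-isEquivalence = record
    { refl  = pure ≡.refl
    ; sym   = ¬¬-map ≡.sym
    ; trans = λ x≈y y≈z → x≈y >>= λ x≡y → ¬¬-map (≡.trans x≡y) y≈z
    }

  private
    ≈-setoid : Setoid _ _
    ≈-setoid = record { isEquivalence = ≈-isEquivalence }

    cong₂ : ∀ (f : Carrier → Carrier → Carrier) {x y u v} → x ≈ y → u ≈ v → f x u ≈ f y v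
    cong₂ f x≈y u≈v = x≈y >>= λ x≡y → ¬¬-map (≡.cong₂ f x≡y) u≈v

    open Consequences ≈-setoid using (comm∧idʳ⇒id; comm∧invʳ⇒inv; comm∧distrˡ⇒distr)

  isCommutativeRing : IsCommutativeRing _≈_ add mul neg zer one
  isCommutativeRing = record
    { isRing = record
      { +-isAbelianGroup = record
        { isGroup = record
          { isMonoid = record
            { isSemigroup = record
              { isMagma = record { isEquivalence = ≈-isEquivalence ; ∙-cong = cong₂ add }
              ; assoc   = M⊨𝐅 _ add-assoc }
            ; identity = comm∧idʳ⇒id (M⊨𝐅 _ add-comm) (M⊨𝐅 _ add-zero) }
          ; inverse = comm∧invʳ⇒inv (M⊨𝐅 _ add-comm) (M⊨𝐅 _ add-neg)
          ; ⁻¹-cong = ¬¬-map (≡.cong neg) }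
        ; comm = M⊨𝐅 _ add-comm }
      ; *-cong     = cong₂ mul
      ; *-assoc    = M⊨𝐅 _ mul-assoc
      ; *-identity = comm∧idʳ⇒id (M⊨𝐅 _ mul-comm) (M⊨𝐅 _ mul-one)
      ; distrib    = comm∧distrˡ⇒distr (cong₂ add) (M⊨𝐅 _ mul-comm) (M⊨𝐅 _ distrib) }
    ; *-comm = M⊨𝐅 _ mul-comm }

  commutativeRing : CommutativeRing 0ℓ 0ℓ
  commutativeRing = record { isCommutativeRing = isCommutativeRing }

  open CommutativeRing commutativeRing public
    hiding (Carrier; _≈_; isCommutativeRing)
  open CanonicalMap ring public
  open import Algebra.Properties.Ring ring using (x∙y⁻¹≈ε⇒x≈y; [y-z]x≈yx-zx)
  open import Relation.Binary.Reasoning.Setoid setoid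

  *-inverse : ∀ {x} → x ≉ 0# → ¬ ¬ (∃[ y ] x * y ≈ 1#)
  *-inverse = M⊨𝐅 _ inverse _

  x*y≈0⇒x≈0 : ∀ {x y} → y ≉ 0# → x * y ≈ 0# → x ≈ 0#
  x*y≈0⇒x≈0 {x} {y} y≉0 xy≈0 = negated-stable $ *-inverse y≉0 >>= λ (z , yz≈1) → pure $ begin
    x            ≈⟨ *-identityʳ x ⟨
    x * 1#       ≈⟨ *-congˡ yz≈1 ⟨
    x * (y * z)  ≈⟨ *-assoc x y z ⟨
    (x * y) * z  ≈⟨ *-congʳ xy≈0 ⟩
    0# * z       ≈⟨ zeroˡ z ⟩
    0#           ∎

  *-cancelʳ-≉0 : ∀ {x y z} → z ≉ 0# → x * z ≈ y * z → x ≈ y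
  *-cancelʳ-≉0 {x} {y} {z} z≉0 xz≈yz = x∙y⁻¹≈ε⇒x≈y x y $ x*y≈0⇒x≈0 z≉0 $ begin
    (x - y) * z    ≈⟨ [y-z]x≈yx-zx z x y ⟩
    x * z - y * z  ≈⟨ +-congʳ xz≈yz ⟩
    y * z - y * z  ≈⟨ -‿inverseʳ (y * z) ⟩
    0#             ∎

  eval-ones : ∀ {ρ : Fin 0 → Carrier} n → eval M ρ (ones n) ≡ ι n
  eval-ones zero          = ≡.refl
  eval-ones (suc zero)    = ≡.refl
  eval-ones (suc (suc n)) = ≡.cong (_+ 1#) (eval-ones (suc n))

  ⊨ρ⇔ι≉0 : ∀ n → (M ⊨ ρ n) ⇔ (ι n ≉ 0#)
  ⊨ρ⇔ι≉0 n = ≡.subst (λ t → (¬ ¬ ¬ t ≡ 0#) ⇔ (ι n ≉ 0#)) (≡.sym (eval-ones n)) (mk⇔ id id)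

  IsChar : ℕ → Set
  IsChar n = ι n ≈ 0# × (∀ {d} → 1 ≤ d → n ≡ 0 ⊎ d < n → ι d ≉ 0#)

  ⊨CharAx⇔IsChar : ∀ n → (M ⊨ₜ CharAx n) ⇔ IsChar n
  ⊨CharAx⇔IsChar zero = mk⇔
    (λ M⊨ → refl , λ where
      _ (inj₂ ())
      {d} 1≤d (inj₁ _) → Equivalence.to (⊨ρ⇔ι≉0 d) (M⊨ _ (d , 1≤d , ≡.refl)))
    (λ (_ , ι≉0) → λ where
      _ (d , 1≤d , ≡.refl) → Equivalence.from (⊨ρ⇔ι≉0 d) (ι≉0 1≤d (inj₁ ≡.refl)))
  ⊨CharAx⇔IsChar n@(suc _) = mk⇔
    (λ M⊨ → negated-stable (M⊨ _ (inj₂ ≡.refl) ∘ Equivalence.from (⊨ρ⇔ι≉0 n)) , λ where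
      _ (inj₁ ())
      {d} 1≤d (inj₂ d<n) → Equivalence.to (⊨ρ⇔ι≉0 d) (M⊨ _ (inj₁ (d , 1≤d , d<n , ≡.refl))))
    (λ (ιn≈0 , ι≉0) → λ where
      _ (inj₁ (d , 1≤d , d<n , ≡.refl)) → Equivalence.from (⊨ρ⇔ι≉0 d) (ι≉0 1≤d (inj₂ d<n))
      _ (inj₂ ≡.refl) ⊨ρn → Equivalence.to (⊨ρ⇔ι≉0 n) ⊨ρn ιn≈0)

  IsChar⇒Prime : ∀ {n} → 1 ≤ n → IsChar n → Prime n
  IsChar⇒Prime {suc zero}    _ (ι1≈0 , _) = ⊥-elim (M⊨𝐅 _ zero≠one (sym ι1≈0))
  IsChar⇒Prime {n@(suc (suc _))} _ (ιn≈0 , ι≉0) = prime λ (composite {d} d<n d∣n) →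
    let q = quotient d∣n in
    ι≉0 (ℕ.<⇒≤ (quotient>1 d∣n d<n)) (inj₂ (quotient-< d∣n)) $
    x*y≈0⇒x≈0 (ι≉0 (ℕ.<⇒≤ (ℕ.nonTrivial⇒n>1 d)) (inj₂ d<n)) $ begin
      ι q * ι d  ≈⟨ ι-* q d ⟨
      ι (q ℕ.* d) ≡⟨ ≡.cong ι (m∣n⇒n≡quotient*m d∣n) ⟨
      ι n         ≈⟨ ιn≈0 ⟩
      0#          ∎

  ι≈0⇒∃IsChar : ∀ n → 1 ≤ n → ι n ≈ 0# → ¬ ¬ (∃[ m ] 1 ≤ m × IsChar m)
  ι≈0⇒∃IsChar = <-rec _ λ n rec 1≤n ιn≈0 →
    ¬¬-excluded-middle {A = ∃[ d ] 1 ≤ d × d < n × ι d ≈ 0#} >>= λ where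
      (yes (d , 1≤d , d<n , ιd≈0)) → rec d<n 1≤d ιd≈0
      (no ∄d) → pure (n , 1≤n , ιn≈0 , λ where
        1≤d (inj₁ ≡.refl)   → contradiction 1≤n λ ()
        1≤d (inj₂ d<n) ιd≈0 → ∄d (_ , 1≤d , d<n , ιd≈0))

  IsChar⇒PrimeOr0 : ∀ {n} → IsChar n → PrimeOr0 n
  IsChar⇒PrimeOr0 {zero}  _      = inj₂ ≡.refl
  IsChar⇒PrimeOr0 {suc _} n-char = inj₁ (IsChar⇒Prime (ℕ.s≤s ℕ.z≤n) n-char)

  characteristic : ¬ ¬ (∃[ p ] IsChar p)
  characteristic = ¬¬-excluded-middle {A = ∃[ n ] 1 ≤ n × ι n ≈ 0#} >>= λ where
    (no ∄n) → pure (0 , refl , λ {d} 1≤d _ ιd≈0 → ∄n (d , 1≤d , ιd≈0))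
    (yes (n , 1≤n , ιn≈0)) → ¬¬-map (Product.map₂ proj₂) (ι≈0⇒∃IsChar n 1≤n ιn≈0)

coprime⇒mod-inverse : ∀ {p m} .{{_ : NonZero p}} → Coprime p m → ∃[ n ] (m ℕ.* n) % p ≡ 1 % p
coprime⇒mod-inverse {p@(suc k)} {m} coprime with coprime-Bézout coprime
-- y m ≡ -1 (mod p), so y (p - 1) inverts m
... | Bézout.+- x y 1+ym≡xp = y ℕ.* k , (begin
  (m ℕ.* (y ℕ.* k)) % p                  ≡⟨ [m+kn]%n≡m%n (m ℕ.* (y ℕ.* k)) x p ⟨
  (m ℕ.* (y ℕ.* k) ℕ.+ x ℕ.* p) % p      ≡⟨ ≡.cong (λ t → (m ℕ.* (y ℕ.* k) ℕ.+ t) % p) 1+ym≡xp ⟨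
  (m ℕ.* (y ℕ.* k) ℕ.+ (1 ℕ.+ y ℕ.* m)) % p ≡⟨ ≡.cong (_% p) (regroup m y k) ⟩
  (1 ℕ.+ (y ℕ.* m) ℕ.* p) % p            ≡⟨ [m+kn]%n≡m%n 1 (y ℕ.* m) p ⟩
  1 % p                                  ∎)
  where
  open ≡-Reasoning
  regroup : ∀ m y k → m ℕ.* (y ℕ.* k) ℕ.+ (1 ℕ.+ y ℕ.* m) ≡ 1 ℕ.+ (y ℕ.* m) ℕ.* suc k
  regroup = solve-∀
... | Bézout.-+ x y 1+xp≡ym = y , (begin
  (m ℕ.* y) % p          ≡⟨ ≡.cong (_% p) (ℕ.*-comm m y) ⟩
  (y ℕ.* m) % p          ≡⟨ ≡.cong (_% p) 1+xp≡ym ⟨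
  (1 ℕ.+ x ℕ.* p) % p    ≡⟨ [m+kn]%n≡m%n 1 x p ⟩
  1 % p                  ∎)
  where open ≡-Reasoning

module ℤmodProperties (k : ℕ) where
  open Structure (ℤmod k)
  open ≡-Reasoning

  private
    p : ℕ
    p = suc k

  -- Definitionally add a b = [ toℕ a + toℕ b ], mul a b = [ toℕ a * toℕ b ] and
  -- neg a = [ p ∸ toℕ a ]; the ring laws are transported from ℕ along [_].
  [_] : ℕ → Fin p
  [ m ] = m mod p

  toℕ-[] : ∀ m → toℕ [ m ] ≡ m % p
  toℕ-[] m = toℕ-fromℕ< _

  []-≡ : ∀ m n → m % p ≡ n % p → [ m ] ≡ [ n ]
  []-≡ m n eq = toℕ-injective (≡.trans (toℕ-[] m) (≡.trans eq (≡.sym (toℕ-[] n))))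

  [toℕ] : ∀ a → [ toℕ a ] ≡ a
  [toℕ] a = toℕ-injective (≡.trans (toℕ-[] (toℕ a)) (m<n⇒m%n≡m (toℕ<n a)))

  []-+ : ∀ m n → add [ m ] [ n ] ≡ [ m ℕ.+ n ]
  []-+ m n = []-≡ (toℕ [ m ] ℕ.+ toℕ [ n ]) (m ℕ.+ n) $ begin
    (toℕ [ m ] ℕ.+ toℕ [ n ]) % p ≡⟨ ≡.cong₂ (λ x y → (x ℕ.+ y) % p) (toℕ-[] m) (toℕ-[] n) ⟩
    (m % p ℕ.+ n % p) % p         ≡⟨ %-distribˡ-+ m n p ⟨
    (m ℕ.+ n) % p                 ∎

  []-* : ∀ m n → mul [ m ] [ n ] ≡ [ m ℕ.* n ]
  []-* m n = []-≡ (toℕ [ m ] ℕ.* toℕ [ n ]) (m ℕ.* n) $ begin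
    (toℕ [ m ] ℕ.* toℕ [ n ]) % p ≡⟨ ≡.cong₂ (λ x y → (x ℕ.* y) % p) (toℕ-[] m) (toℕ-[] n) ⟩
    (m % p ℕ.* (n % p)) % p       ≡⟨ %-distribˡ-* m n p ⟨
    (m ℕ.* n) % p                 ∎

  add-[]ˡ : ∀ m a → add [ m ] a ≡ [ m ℕ.+ toℕ a ]
  add-[]ˡ m a = ≡.trans (≡.cong (add [ m ]) (≡.sym ([toℕ] a))) ([]-+ m (toℕ a))

  add-[]ʳ : ∀ a m → add a [ m ] ≡ [ toℕ a ℕ.+ m ]
  add-[]ʳ a m = ≡.trans (≡.cong (λ x → add x [ m ]) (≡.sym ([toℕ] a))) ([]-+ (toℕ a) m)

  mul-[]ˡ : ∀ m a → mul [ m ] a ≡ [ m ℕ.* toℕ a ]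
  mul-[]ˡ m a = ≡.trans (≡.cong (mul [ m ]) (≡.sym ([toℕ] a))) ([]-* m (toℕ a))

  mul-[]ʳ : ∀ a m → mul a [ m ] ≡ [ toℕ a ℕ.* m ]
  mul-[]ʳ a m = ≡.trans (≡.cong (λ x → mul x [ m ]) (≡.sym ([toℕ] a))) ([]-* (toℕ a) m)

  +-assoc : ∀ a b c → add (add a b) c ≡ add a (add b c)
  +-assoc a b c = begin
    add [ toℕ a ℕ.+ toℕ b ] c     ≡⟨ add-[]ˡ (toℕ a ℕ.+ toℕ b) c ⟩
    [ toℕ a ℕ.+ toℕ b ℕ.+ toℕ c ]   ≡⟨ ≡.cong [_] (ℕ.+-assoc (toℕ a) _ _) ⟩
    [ toℕ a ℕ.+ (toℕ b ℕ.+ toℕ c) ] ≡⟨ add-[]ʳ a (toℕ b ℕ.+ toℕ c) ⟨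
    add a [ toℕ b ℕ.+ toℕ c ]     ∎

  *-assoc : ∀ a b c → mul (mul a b) c ≡ mul a (mul b c)
  *-assoc a b c = begin
    mul [ toℕ a ℕ.* toℕ b ] c     ≡⟨ mul-[]ˡ (toℕ a ℕ.* toℕ b) c ⟩
    [ toℕ a ℕ.* toℕ b ℕ.* toℕ c ]   ≡⟨ ≡.cong [_] (ℕ.*-assoc (toℕ a) _ _) ⟩
    [ toℕ a ℕ.* (toℕ b ℕ.* toℕ c) ] ≡⟨ mul-[]ʳ a (toℕ b ℕ.* toℕ c) ⟨
    mul a [ toℕ b ℕ.* toℕ c ]     ∎

  +-comm : ∀ a b → add a b ≡ add b a
  +-comm a b = ≡.cong [_] (ℕ.+-comm (toℕ a) (toℕ b))

  *-comm : ∀ a b → mul a b ≡ mul b a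
  *-comm a b = ≡.cong [_] (ℕ.*-comm (toℕ a) (toℕ b))

  +-identityʳ : ∀ a → add a zer ≡ a
  +-identityʳ a = ≡.trans (add-[]ʳ a 0) (≡.trans (≡.cong [_] (ℕ.+-identityʳ (toℕ a))) ([toℕ] a))

  *-identityʳ : ∀ a → mul a one ≡ a
  *-identityʳ a = ≡.trans (mul-[]ʳ a 1) (≡.trans (≡.cong [_] (ℕ.*-identityʳ (toℕ a))) ([toℕ] a))

  +-inverseʳ : ∀ a → add a (neg a) ≡ zer
  +-inverseʳ a = begin
    add a [ p ∸ toℕ a ]      ≡⟨ add-[]ʳ a (p ∸ toℕ a) ⟩
    [ toℕ a ℕ.+ (p ∸ toℕ a) ] ≡⟨ ≡.cong [_] (ℕ.m+[n∸m]≡n (ℕ.<⇒≤ (toℕ<n a))) ⟩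
    [ p ]                    ≡⟨ []-≡ p 0 (n%n≡0 p) ⟩
    [ 0 ]                    ∎

  *-distribˡ-+ : ∀ a b c → mul a (add b c) ≡ add (mul a b) (mul a c)
  *-distribˡ-+ a b c = begin
    mul a [ toℕ b ℕ.+ toℕ c ]                ≡⟨ mul-[]ʳ a (toℕ b ℕ.+ toℕ c) ⟩
    [ toℕ a ℕ.* (toℕ b ℕ.+ toℕ c) ]          ≡⟨ ≡.cong [_] (ℕ.*-distribˡ-+ (toℕ a) _ _) ⟩
    [ toℕ a ℕ.* toℕ b ℕ.+ toℕ a ℕ.* toℕ c ]  ≡⟨ []-+ (toℕ a ℕ.* toℕ b) (toℕ a ℕ.* toℕ c) ⟨
    add (mul a b) (mul a c)                  ∎

  *-inverseʳ : Prime p → ∀ a → a ≢ zer → ∃[ b ] mul a b ≡ one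
  *-inverseʳ p-prime a a≢0 =
    let instance _ = ℕ.≢-nonZero (a≢0 ∘ toℕ-injective)
        n , an≡1 = coprime⇒mod-inverse (prime⇒coprime p-prime (toℕ<n a))
    in [ n ] , ≡.trans (mul-[]ʳ a n) ([]-≡ (toℕ a ℕ.* n) 1 an≡1)

  ℤmod⊨𝐅 : Prime p → ℤmod k ⊨ₜ 𝐅
  ℤmod⊨𝐅 _ _ add-assoc = λ a b c → pure (+-assoc a b c)
  ℤmod⊨𝐅 _ _ add-zero  = λ a → pure (+-identityʳ a)
  ℤmod⊨𝐅 _ _ add-neg   = λ a → pure (+-inverseʳ a)
  ℤmod⊨𝐅 _ _ add-comm  = λ a b → pure (+-comm a b)
  ℤmod⊨𝐅 _ _ mul-assoc = λ a b c → pure (*-assoc a b c)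
  ℤmod⊨𝐅 _ _ mul-one   = λ a → pure (*-identityʳ a)
  ℤmod⊨𝐅 _ _ mul-comm  = λ a b → pure (*-comm a b)
  ℤmod⊨𝐅 _ _ distrib   = λ a b c → pure (*-distribˡ-+ a b c)
  ℤmod⊨𝐅 p-prime _ zero≠one = λ 0≈1 → 0≈1 λ 0≡1 →
    let instance _ = prime⇒nonTrivial p-prime
    in contradiction (≡.trans (≡.cong toℕ 0≡1) (≡.trans (toℕ-[] 1) (m<n⇒m%n≡m (ℕ.nonTrivial⇒n>1 p)))) λ ()
  ℤmod⊨𝐅 p-prime _ inverse = λ a a≉0 →
    let b , ab≡1 = *-inverseʳ p-prime a (a≉0 ∘ pure) in pure (b , pure ab≡1)

  eval-ones : ∀ {ρ : Fin 0 → Fin p} n → eval (ℤmod k) ρ (ones n) ≡ [ n ]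
  eval-ones zero          = ≡.refl
  eval-ones (suc zero)    = ≡.refl
  eval-ones (suc (suc n)) = begin
    add (eval (ℤmod k) _ (ones (suc n))) one ≡⟨ ≡.cong (λ x → add x one) (eval-ones (suc n)) ⟩
    add [ suc n ] [ 1 ]                     ≡⟨ []-+ (suc n) 1 ⟩
    [ suc n ℕ.+ 1 ]                         ≡⟨ ≡.cong [_] (ℕ.+-comm (suc n) 1) ⟩
    [ suc (suc n) ]                         ∎

  ℤmod⊨CharAx : ℤmod k ⊨ₜ CharAx p
  ℤmod⊨CharAx _ (inj₁ (d , 1≤d , d<p , ≡.refl)) = λ d≈0 → d≈0 λ d≡0 →
    contradiction (begin
      d           ≡⟨ m<n⇒m%n≡m d<p ⟨
      d % p       ≡⟨ toℕ-[] d ⟨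
      toℕ [ d ]   ≡⟨ ≡.cong toℕ (≡.trans (≡.sym (eval-ones d)) d≡0) ⟩
      0           ∎) (ℕ.>⇒≢ 1≤d)
  ℤmod⊨CharAx _ (inj₂ ≡.refl) = λ ⊨ρp → ⊨ρp (pure (≡.trans (eval-ones p) ([]-≡ p 0 (n%n≡0 p))))

ℚ⊨𝐅 : ℚ-str ⊨ₜ 𝐅
ℚ⊨𝐅 _ add-assoc = λ a b c → pure (ℚ.+-assoc a b c)
ℚ⊨𝐅 _ add-zero  = λ a → pure (ℚ.+-identityʳ a)
ℚ⊨𝐅 _ add-neg   = λ a → pure (ℚ.+-inverseʳ a)
ℚ⊨𝐅 _ add-comm  = λ a b → pure (ℚ.+-comm a b)
ℚ⊨𝐅 _ mul-assoc = λ a b c → pure (ℚ.*-assoc a b c)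
ℚ⊨𝐅 _ mul-one   = λ a → pure (ℚ.*-identityʳ a)
ℚ⊨𝐅 _ mul-comm  = λ a b → pure (ℚ.*-comm a b)
ℚ⊨𝐅 _ distrib   = λ a b c → pure (ℚ.*-distribˡ-+ a b c)
ℚ⊨𝐅 _ zero≠one  = λ 0≈1 → 0≈1 (ℚ.1≢0 ∘ ≡.sym)
ℚ⊨𝐅 _ inverse   = λ a a≉0 →
  let instance _ = ℚ.≢-nonZero (a≉0 ∘ pure) in pure (ℚ.1/ a , pure (ℚ.*-inverseʳ a))

ones-positive : ∀ {ρ} n → 0ℚ ℚ.< eval ℚ-str ρ (ones (suc n))
ones-positive zero    = ℚ.positive⁻¹ 1ℚ
ones-positive (suc n) = ℚ.+-mono-< (ones-positive n) (ℚ.positive⁻¹ 1ℚ)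

ℚ⊨CharAx : ℚ-str ⊨ₜ CharAx 0
ℚ⊨CharAx _ (suc n , _ , ≡.refl) = λ n≈0 → n≈0 (ℚ.<⇒≢ (ones-positive n) ∘ ≡.sym)

𝔽⊨𝐅 : ∀ {p} → PrimeOr0 p → 𝔽 p ⊨ₜ 𝐅
𝔽⊨𝐅 {zero}  _               = ℚ⊨𝐅
𝔽⊨𝐅 {suc k} (inj₁ p-prime) = ℤmodProperties.ℤmod⊨𝐅 k p-prime

𝔽⊨CharAx : ∀ p → 𝔽 p ⊨ₜ CharAx p
𝔽⊨CharAx zero    = ℚ⊨CharAx
𝔽⊨CharAx (suc k) = ℤmodProperties.ℤmod⊨CharAx k

module PrimeSubfield (M : Structure) (M⊨𝐅 : M ⊨ₜ 𝐅) where
  open Structure M using (Carrier)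
  open FieldModel M M⊨𝐅
  open import Algebra.Properties.Ring ring
    using (-‿distribˡ-*; +-identityʳ-unique; +-inverseˡ-unique; -‿involutive; -0#≈0#)
  open import Relation.Binary.Reasoning.Setoid setoid

  module _ {k} (p-char : IsChar (suc k)) where
    open ℤmodProperties k using ([_]; toℕ-[])

    private
      p : ℕ
      p = suc k

      ιp≈0 : ι p ≈ 0#
      ιp≈0 = proj₁ p-char

      ι≉0 : ∀ {d} → 1 ≤ d → p ≡ 0 ⊎ d < p → ι d ≉ 0#
      ι≉0 = proj₂ p-char

    ι-% : ∀ m → ι (m % p) ≈ ι m
    ι-% m = sym $ begin
      ι m                           ≡⟨ ≡.cong ι (m≡m%n+[m/n]*n m p) ⟩
      ι (m % p ℕ.+ m / p ℕ.* p)     ≈⟨ ι-+ (m % p) (m / p ℕ.* p) ⟩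
      ι (m % p) + ι (m / p ℕ.* p)   ≈⟨ +-congˡ (ι-* (m / p) p) ⟩
      ι (m % p) + ι (m / p) * ι p   ≈⟨ +-congˡ (trans (*-congˡ ιp≈0) (zeroʳ (ι (m / p)))) ⟩
      ι (m % p) + 0#                ≈⟨ +-identityʳ (ι (m % p)) ⟩
      ι (m % p)                     ∎

    ι-toℕ[] : ∀ m → ι (toℕ [ m ]) ≈ ι m
    ι-toℕ[] m = trans (reflexive (≡.cong ι (toℕ-[] m))) (ι-% m)

    ι-∸ : ∀ {t} → t ≤ p → ι (p ∸ t) ≈ - ι t
    ι-∸ {t} t≤p = +-inverseˡ-unique (ι (p ∸ t)) (ι t) $ begin
      ι (p ∸ t) + ι t    ≈⟨ ι-+ (p ∸ t) t ⟨
      ι (p ∸ t ℕ.+ t)    ≡⟨ ≡.cong ι (ℕ.m∸n+n≡m t≤p) ⟩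
      ι p                ≈⟨ ιp≈0 ⟩
      0#                 ∎

    ι-distinct : ∀ {m n} → m < n → n < p → ι m ≉ ι n
    ι-distinct {m} {n} m<n n<p ιm≈ιn = ι≉0 (ℕ.m<n⇒0<n∸m m<n) (inj₂ (ℕ.≤-<-trans (ℕ.m∸n≤m n m) n<p)) $
      +-identityʳ-unique (ι m) (ι (n ∸ m)) $ begin
        ι m + ι (n ∸ m)    ≈⟨ ι-+ m (n ∸ m) ⟨
        ι (m ℕ.+ (n ∸ m))  ≡⟨ ≡.cong ι (ℕ.m+[n∸m]≡n (ℕ.<⇒≤ m<n)) ⟩
        ι n                ≈⟨ ιm≈ιn ⟨
        ι m                ∎

    ι-injective : ∀ {m n} → m < p → n < p → ι m ≈ ι n → m ≡ n
    ι-injective {m} {n} m<p n<p ιm≈ιn with ℕ.<-cmp m n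
    ... | tri< m<n _ _ = contradiction ιm≈ιn (ι-distinct m<n n<p)
    ... | tri≈ _ m≡n _ = m≡n
    ... | tri> _ _ n<m = contradiction (sym ιm≈ιn) (ι-distinct n<m m<p)

    ℤmod-embedding : Embedding (ℤmod k) M
    ℤmod-embedding = record
      { _∼_          = λ a b → ι (toℕ a) ≈ b
      ; ∼-total      = λ a → pure (ι (toℕ a) , refl)
      ; ∼-zer        = ι-toℕ[] 0
      ; ∼-one        = ι-toℕ[] 1
      ; ∼-add        = λ {a} {_} {c} a∼b c∼d →
          trans (ι-toℕ[] (toℕ a ℕ.+ toℕ c)) (trans (ι-+ (toℕ a) (toℕ c)) (+-cong a∼b c∼d))
      ; ∼-mul        = λ {a} {_} {c} a∼b c∼d →
          trans (ι-toℕ[] (toℕ a ℕ.* toℕ c)) (trans (ι-* (toℕ a) (toℕ c)) (*-cong a∼b c∼d))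
      ; ∼-neg        = λ {a} a∼b →
          trans (ι-toℕ[] (p ∸ toℕ a)) (trans (ι-∸ (ℕ.<⇒≤ (toℕ<n a))) (-‿cong a∼b))
      ; ∼-functional = λ a∼b a∼c → trans (sym a∼b) a∼c
      ; ∼-injective  = λ {a} {b} a∼c b∼c →
          pure (toℕ-injective (ι-injective (toℕ<n a) (toℕ<n b) (trans a∼c (sym b∼c))))
      }

  module _ (0-char : IsChar 0) where
    open import Algebra.Properties.CommutativeSemigroup *-commutativeSemigroup
      using (xy∙z≈xz∙y; x∙yz≈xz∙y) renaming (interchange to *-interchange)

    ι-suc≉0 : ∀ n → ι (suc n) ≉ 0#
    ι-suc≉0 n = proj₂ 0-char {suc n} (ℕ.s≤s ℕ.z≤n) (inj₁ ≡.refl)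

    ιℤ≈0⇒≡0 : ∀ {i} → ιℤ i ≈ 0# → i ≡ + 0
    ιℤ≈0⇒≡0 {+ zero}    _     = ≡.refl
    ιℤ≈0⇒≡0 {+ suc n}   ιi≈0 = contradiction ιi≈0 (ι-suc≉0 n)
    ιℤ≈0⇒≡0 { -[1+ n ]} ιi≈0 =
      contradiction (trans (sym (-‿involutive _)) (trans (-‿cong ιi≈0) -0#≈0#)) (ι-suc≉0 n)

    ιℤ-injective : ∀ {i j} → ιℤ i ≈ ιℤ j → i ≡ j
    ιℤ-injective {i} {j} ιi≈ιj = ℤ.i-j≡0⇒i≡j i j $ ιℤ≈0⇒≡0 $ begin
      ιℤ (i ℤ.- j)       ≈⟨ ιℤ-+ i (ℤ.- j) ⟩
      ιℤ i + ιℤ (ℤ.- j)  ≈⟨ +-cong ιi≈ιj (ιℤ-neg j) ⟩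
      ιℤ j - ιℤ j        ≈⟨ -‿inverseʳ (ιℤ j) ⟩
      0#                 ∎

    infix 4 _∼ᵘ_
    _∼ᵘ_ : ℚᵘ → Carrier → Set
    mkℚᵘ n d ∼ᵘ b = b * ι (suc d) ≈ ιℤ n

    ∼ᵘ-resp-≃ : ∀ x y {b} → x ≃ y → x ∼ᵘ b → y ∼ᵘ b
    ∼ᵘ-resp-≃ (mkℚᵘ n d) (mkℚᵘ m e) {b} (*≡* n*e≡m*d) x∼b = *-cancelʳ-≉0 (ι-suc≉0 d) $ begin
      (b * ι (suc e)) * ι (suc d)  ≈⟨ xy∙z≈xz∙y b (ι (suc e)) (ι (suc d)) ⟩
      (b * ι (suc d)) * ι (suc e)  ≈⟨ *-congʳ x∼b ⟩
      ιℤ n * ι (suc e)             ≈⟨ ιℤ-* n (+ suc e) ⟨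
      ιℤ (n ℤ.* + suc e)           ≡⟨ ≡.cong ιℤ n*e≡m*d ⟩
      ιℤ (m ℤ.* + suc d)           ≈⟨ ιℤ-* m (+ suc d) ⟩
      ιℤ m * ι (suc d)             ∎

    ∼ᵘ-total : ∀ x → ¬ ¬ (∃[ b ] x ∼ᵘ b)
    ∼ᵘ-total (mkℚᵘ n d) = *-inverse (ι-suc≉0 d) >>= λ (u , du≈1) → pure $ ιℤ n * u , (begin
      (ιℤ n * u) * ι (suc d)  ≈⟨ *-assoc (ιℤ n) u (ι (suc d)) ⟩
      ιℤ n * (u * ι (suc d))  ≈⟨ *-congˡ (trans (*-comm u (ι (suc d))) du≈1) ⟩
      ιℤ n * 1#               ≈⟨ *-identityʳ (ιℤ n) ⟩
      ιℤ n                    ∎)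

    ∼ᵘ-+ : ∀ x y {b c} → x ∼ᵘ b → y ∼ᵘ c → x ℚᵘ.+ y ∼ᵘ b + c
    ∼ᵘ-+ (mkℚᵘ n d) (mkℚᵘ m e) {b} {c} x∼b y∼c = begin
      (b + c) * ι (suc d ℕ.* suc e)           ≈⟨ *-congˡ (ι-* (suc d) (suc e)) ⟩
      (b + c) * (ι (suc d) * ι (suc e))       ≈⟨ distribʳ _ b c ⟩
      b * (ι (suc d) * ι (suc e)) + c * (ι (suc d) * ι (suc e))
        ≈⟨ +-cong (sym (*-assoc b _ _)) (x∙yz≈xz∙y c _ _) ⟩
      b * ι (suc d) * ι (suc e) + c * ι (suc e) * ι (suc d)
        ≈⟨ +-cong (*-congʳ x∼b) (*-congʳ y∼c) ⟩
      ιℤ n * ι (suc e) + ιℤ m * ι (suc d)     ≈⟨ +-cong (ιℤ-* n (+ suc e)) (ιℤ-* m (+ suc d)) ⟨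
      ιℤ (n ℤ.* + suc e) + ιℤ (m ℤ.* + suc d) ≈⟨ ιℤ-+ (n ℤ.* + suc e) (m ℤ.* + suc d) ⟨
      ιℤ (n ℤ.* + suc e ℤ.+ m ℤ.* + suc d)    ∎

    ∼ᵘ-* : ∀ x y {b c} → x ∼ᵘ b → y ∼ᵘ c → x ℚᵘ.* y ∼ᵘ b * c
    ∼ᵘ-* (mkℚᵘ n d) (mkℚᵘ m e) {b} {c} x∼b y∼c = begin
      (b * c) * ι (suc d ℕ.* suc e)           ≈⟨ *-congˡ (ι-* (suc d) (suc e)) ⟩
      (b * c) * (ι (suc d) * ι (suc e))       ≈⟨ *-interchange b c (ι (suc d)) (ι (suc e)) ⟩
      (b * ι (suc d)) * (c * ι (suc e))       ≈⟨ *-cong x∼b y∼c ⟩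
      ιℤ n * ιℤ m                             ≈⟨ ιℤ-* n m ⟨
      ιℤ (n ℤ.* m)                            ∎

    ∼ᵘ-neg : ∀ x {b} → x ∼ᵘ b → ℚᵘ.- x ∼ᵘ - b
    ∼ᵘ-neg (mkℚᵘ n d) {b} x∼b = begin
      - b * ι (suc d)    ≈⟨ -‿distribˡ-* b (ι (suc d)) ⟨
      - (b * ι (suc d))  ≈⟨ -‿cong x∼b ⟩
      - ιℤ n             ≈⟨ ιℤ-neg n ⟨
      ιℤ (ℤ.- n)         ∎

    ∼ᵘ-functional : ∀ x {b c} → x ∼ᵘ b → x ∼ᵘ c → b ≈ c
    ∼ᵘ-functional (mkℚᵘ n d) x∼b x∼c = *-cancelʳ-≉0 (ι-suc≉0 d) (trans x∼b (sym x∼c))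

    ∼ᵘ-injective : ∀ x y {b} → x ∼ᵘ b → y ∼ᵘ b → x ≃ y
    ∼ᵘ-injective (mkℚᵘ n d) (mkℚᵘ m e) {b} x∼b y∼b = *≡* $ ιℤ-injective $ begin
      ιℤ (n ℤ.* + suc e)           ≈⟨ ιℤ-* n (+ suc e) ⟩
      ιℤ n * ι (suc e)             ≈⟨ *-congʳ x∼b ⟨
      (b * ι (suc d)) * ι (suc e)  ≈⟨ xy∙z≈xz∙y b (ι (suc d)) (ι (suc e)) ⟩
      (b * ι (suc e)) * ι (suc d)  ≈⟨ *-congʳ y∼b ⟩
      ιℤ m * ι (suc d)             ≈⟨ ιℤ-* m (+ suc d) ⟨
      ιℤ (m ℤ.* + suc d)           ∎

    ℚ-embedding : Embedding ℚ-str M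
    ℚ-embedding = record
      { _∼_          = λ q b → toℚᵘ q ∼ᵘ b
      ; ∼-total      = λ q → ∼ᵘ-total (toℚᵘ q)
      ; ∼-zer        = zeroˡ 1#
      ; ∼-one        = *-identityˡ 1#
      ; ∼-add        = λ {q} {_} {r} q∼b r∼c → ∼ᵘ-resp-≃ _ (toℚᵘ (q ℚ.+ r))
          (ℚᵘ.≃-sym (ℚ.toℚᵘ-homo-+ q r)) (∼ᵘ-+ (toℚᵘ q) (toℚᵘ r) q∼b r∼c)
      ; ∼-mul        = λ {q} {_} {r} q∼b r∼c → ∼ᵘ-resp-≃ _ (toℚᵘ (q ℚ.* r))
          (ℚᵘ.≃-sym (ℚ.toℚᵘ-homo-* q r)) (∼ᵘ-* (toℚᵘ q) (toℚᵘ r) q∼b r∼c)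
      ; ∼-neg        = λ {q} q∼b → ∼ᵘ-resp-≃ _ (toℚᵘ (ℚ.- q))
          (ℚᵘ.≃-sym (ℚ.toℚᵘ-homo‿- q)) (∼ᵘ-neg (toℚᵘ q) q∼b)
      ; ∼-functional = λ {q} q∼b q∼c → ∼ᵘ-functional (toℚᵘ q) q∼b q∼c
      ; ∼-injective  = λ {q} {r} q∼c r∼c → pure (ℚ.toℚᵘ-injective (∼ᵘ-injective (toℚᵘ q) (toℚᵘ r) q∼c r∼c))
      }

  𝔽-embedding : ∀ {p} → IsChar p → Embedding (𝔽 p) M
  𝔽-embedding {zero}  = ℚ-embedding
  𝔽-embedding {suc k} = ℤmod-embedding

Cl-mono : ∀ {a b} {S : Theory a} {T : Theory b} → S ⊆ T → Cl S ⊆ Cl T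
Cl-mono S⊆T φ∈ClS M M⊨T = φ∈ClS M (λ ψ → M⊨T ψ ∘ S⊆T)

at-mono : ∀ {a b} {S : Theory a} {T : Theory b} {n} → S ⊆ T → (S at n) ⊆ (T at n)
at-mono S⊆T = Cl-mono (Sum.map₁ S⊆T)

⊆-antisym : ∀ {a b} {S : Theory a} {T : Theory b} → S ⊆ T → T ⊆ S → S ≗ₜ T
⊆-antisym S⊆T T⊆S φ = S⊆T , T⊆S

>0∃-mono : ∀ {a b} {S : Theory a} {T : Theory b} → (∀ n → (S at n ∃) ⊆ (T at n ∃)) → (S >0∃) ⊆ (T >0∃)
>0∃-mono S⊆T (φ∈S , e) = (λ n 1≤n → proj₁ (S⊆T n (φ∈S n 1≤n , e))) , e

≫0∃-mono : ∀ {a b} {S : Theory a} {T : Theory b} → (∀ n → (S at n ∃) ⊆ (T at n ∃)) → (S ≫0∃) ⊆ (T ≫0∃)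
≫0∃-mono S⊆T ((m , φ∈S) , e) = (m , λ n m≤n 1≤n → proj₁ (S⊆T n (φ∈S n m≤n 1≤n , e))) , e

𝐅⊆𝐏 : 𝐅 ⊆ 𝐏
𝐅⊆𝐏 {ψ} ψ∈𝐅 p p-prime = 𝔽⊨𝐅 p-prime ψ ψ∈𝐅

𝔽⊨𝐏∪CharAx : ∀ {p} → PrimeOr0 p → 𝔽 p ⊨ₜ (𝐏 ∪ CharAx p)
𝔽⊨𝐏∪CharAx {p} p-prime ψ = Sum.[ (λ ψ∈𝐏 → ψ∈𝐏 p p-prime) , 𝔽⊨CharAx p ψ ]

module _ {n M} (M⊨ : M ⊨ₜ (𝐅 ∪ CharAx n)) where
  private
    M⊨𝐅 : M ⊨ₜ 𝐅
    M⊨𝐅 ψ = M⊨ ψ ∘ inj₁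

    n-char : FieldModel.IsChar M M⊨𝐅 n
    n-char = Equivalence.to (FieldModel.⊨CharAx⇔IsChar M M⊨𝐅 n) (λ ψ → M⊨ ψ ∘ inj₂)

  model-𝔽-embedding : Embedding (𝔽 n) M
  model-𝔽-embedding = PrimeSubfield.𝔽-embedding M M⊨𝐅 n-char

  model-char-primeOr0 : PrimeOr0 n
  model-char-primeOr0 = FieldModel.IsChar⇒PrimeOr0 M M⊨𝐅 n-char

𝐅∃⊆𝐏∃ : (𝐅 ∃ₜ) ⊆ (𝐏 ∃ₜ)
𝐅∃⊆𝐏∃ = Product.map₁ (Cl-mono 𝐅⊆𝐏)

𝐏∃⊆𝐅∃ : (𝐏 ∃ₜ) ⊆ (𝐅 ∃ₜ)
𝐏∃⊆𝐅∃ {φ} (φ∈ClP , e) = (λ M M⊨𝐅 → Sat-stable M _ φ $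
    FieldModel.characteristic M M⊨𝐅 >>= λ (p , p-char) →
    pure (SentEx-preserved (PrimeSubfield.𝔽-embedding M M⊨𝐅 p-char) e
      (φ∈ClP (𝔽 p) λ ψ ψ∈𝐏 → ψ∈𝐏 p (FieldModel.IsChar⇒PrimeOr0 M M⊨𝐅 p-char))))
  , e

𝐅-at∃⊆𝐏-at∃ : ∀ n → (𝐅 at n ∃) ⊆ (𝐏 at n ∃)
𝐅-at∃⊆𝐏-at∃ n = Product.map₁ (at-mono 𝐅⊆𝐏)

𝐏-at∃⊆Th∃ : ∀ {p} → PrimeOr0 p → (𝐏 at p ∃) ⊆ Th∃ (𝔽 p)
𝐏-at∃⊆Th∃ {p} p-prime = Product.map₁ λ φ∈ → φ∈ (𝔽 p) (𝔽⊨𝐏∪CharAx p-prime)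

Th∃⊆𝐅-at∃ : ∀ p → Th∃ (𝔽 p) ⊆ (𝐅 at p ∃)
Th∃⊆𝐅-at∃ p (𝔽⊨φ , e) = (λ M M⊨ → SentEx-preserved (model-𝔽-embedding M⊨) e 𝔽⊨φ) , e

𝐏-at∃⊆𝐅-at∃ : ∀ n → (𝐏 at n ∃) ⊆ (𝐅 at n ∃)
𝐏-at∃⊆𝐅-at∃ n (φ∈ , e) =
  (λ M M⊨ → SentEx-preserved (model-𝔽-embedding M⊨) e (φ∈ (𝔽 n) (𝔽⊨𝐏∪CharAx (model-char-primeOr0 M⊨)))) , e

proposition5p6 : ((p : ℕ) → PrimeOr0 p → ((𝐅 at p ∃) ≗ₜ (𝐏 at p ∃)) × ((𝐏 at p ∃) ≗ₜ Th∃ (𝔽 p)))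
    × ((𝐅 ∃ₜ) ≗ₜ (𝐏 ∃ₜ))
    × ((𝐅 >0∃) ≗ₜ (𝐏 >0∃))
    × ((𝐅 ≫0∃) ≗ₜ (𝐏 ≫0∃))
proposition5p6 =
    (λ p p-prime → ⊆-antisym (𝐅-at∃⊆𝐏-at∃ p) (𝐏-at∃⊆𝐅-at∃ p)
                 , ⊆-antisym (𝐏-at∃⊆Th∃ p-prime) (𝐅-at∃⊆𝐏-at∃ p ∘ Th∃⊆𝐅-at∃ p))
  , ⊆-antisym 𝐅∃⊆𝐏∃ 𝐏∃⊆𝐅∃
  , ⊆-antisym (>0∃-mono 𝐅-at∃⊆𝐏-at∃) (>0∃-mono 𝐏-at∃⊆𝐅-at∃)
  , ⊆-antisym (≫0∃-mono 𝐅-at∃⊆𝐏-at∃) (≫0∃-mono 𝐏-at∃⊆𝐅-at∃)
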